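{- Let $m\le n$ be positive integers, let $(\pi_2,\dots,\pi_m)\in[n]^{m-1}$ and let $k\in[n]$. Then $A^n_{(\pi_2,\dots,\pi_m)}=[k]$ if and only if $(\pi_2,\dots,\pi_m)\in Sh_m(k-1,n-k)$.
   Context: $[n]=\{1,\dots,n\}$. For integers $0\le r\le s$, $\mathrm{PF}_{r,s}$ is the set of $(r,s)$-parking functions: sequences $(c_1,\dots,c_r)\in[s]^r$ whose nondecreasing rearrangement $c'_1\le\dots\le c'_r$ satisfies $c'_i\le s-r+i$ for all $i$ (equivalently, when $r$ cars with these preferred spots arrive in order on a one-way street with $s$ spots, each parking in its preferred spot or else the first unoccupied spot after it, all cars park); $\mathrm{PF}_{0,s}$ contains only the empty sequence, and $\mathrm{PF}_{r,s}=\emptyset$ if $r<0$ or $r>s$. For positive integers $M,N$ and $k\in[N]$, $Sh_M(k-1,N-k)$ is the set of all sequences of length $M-1$ that are shuffles (interleavings preserving the internal order of each word) of some word $\gamma\in \mathrm{PF}_{M-N+k-1,\,k-1}$ and the word $(b_1+k,\dots,b_{N-k}+k)$ for some $(b_1,\dots,b_{N-k})\in\mathrm{PF}_{N-k,N-k}$. For $(\pi_2,\dots,\pi_m)\in[n]^{m-1}$, $A^n_{(\pi_2,\dots,\pi_m)}=\{j\in[n]:(j,\pi_2,\dots,\pi_m)\in\mathrm{PF}_{m,n}\}$. -}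

module Defs where

open import Data.Nat using (ℕ; zero; suc; _+_; _∸_; _≤_)
open import Data.Nat.Properties using (≤-decTotalOrder)
open import Data.Fin using (Fin; toℕ)
open import Data.List using (List; []; _∷_; length; map; lookup)
open import Data.List.Relation.Unary.All using (All)
open import Data.List.Relation.Ternary.Interleaving.Propositional using (Interleaving)
open import Data.List.Sort.InsertionSort.Base ≤-decTotalOrder using (sort)
open import Data.Product using (Σ; _×_)
open import Function.Bundles using (_⇔_)
open import Relation.Binary.PropositionalEquality using (_≡_)

InRange : ℕ → ℕ → Set
InRange s x = 1 ≤ x × x ≤ s

-- (r,s)-parking functions, sequences represented as lists of naturals.
-- c ∈ PF_{r,s}  iff  r ≤ s, c has length r, c ∈ [s]^r, and the
-- nondecreasing rearrangement c' (= insertion sort of c) satisfies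
-- c'_i ≤ s - r + i for all i ∈ [r]  (Fin index i is 0-based, so i+1).
IsPF : ℕ → ℕ → List ℕ → Set
IsPF r s c =
  r ≤ s × length c ≡ r × All (InRange s) c ×
  ((i : Fin (length (sort c))) → lookup (sort c) i ≤ (s ∸ r) + suc (toℕ i))

-- Sh_M(k-1, N-k): sequences w of length M-1 that are shuffles of some
-- γ ∈ PF_{M-N+k-1, k-1} and (b_1+k,…,b_{N-k}+k) with b ∈ PF_{N-k,N-k}.
-- The integer M-N+k-1 is represented by a natural r with r + (N-k) + 1 = M;
-- if no such r exists (M-N+k-1 < 0) then PF is empty and so is Sh.
InSh : (M N k : ℕ) → List ℕ → Set
InSh M N k w =
  length w ≡ M ∸ 1 ×
  Σ ℕ λ r → (r + (N ∸ k) + 1 ≡ M) ×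
  Σ (List ℕ) λ γ → Σ (List ℕ) λ b →
    IsPF r (k ∸ 1) γ × IsPF (N ∸ k) (N ∸ k) b ×
    Interleaving γ (map (_+ k) b) w

InA : ℕ → List ℕ → ℕ → Set
InA n π j = InRange n j × IsPF (suc (length π)) n (j ∷ π)

A≡[k] : ℕ → List ℕ → ℕ → Set
A≡[k] n π k = (j : ℕ) → InA n π j ⇔ InRange k j

-- Counting form of the parking condition: c ∈ PF_{r,s} iff for every u ≤ s at least u + r − s
-- entries of c are ≤ u.  For (j, π₂, …, π_m) this says that the bound for π alone holds everywhere
-- and the bound with one extra car holds below j, so A^n_π = [k] exactly when k is the first place
-- where the bound with the extra car fails.  Splitting π into its entries ≤ k − 1 (γ) and the rest,
-- the bounds at k − 1 and k force the rest to exceed k and give n − k = |rest|; the remaining bounds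
-- then separate into the counting conditions for γ ∈ PF_{m−n+k−1,k−1} and for the rest, shifted
-- down by k, in PF_{n−k,n−k}.
module Submission where

open import Defs
open import Data.Nat using (ℕ; suc; _+_; _∸_; _≤_; _<_; z≤n; s≤s; _≤?_)
open import Data.Nat.Properties
open import Data.Nat.Tactic.RingSolver using (solve-∀)
open import Data.Fin using (Fin; toℕ; fromℕ<) renaming (zero to fzero; suc to fsuc)
open import Data.Fin.Properties using (toℕ-fromℕ<; toℕ<n)
open import Data.List using (List; []; _∷_; _++_; length; map; lookup; filter)
open import Data.List.Properties
  using (length-map; length-++; length-filter; filter-accept; filter-reject; filter-all; filter-none; filter-++)
open import Data.List.Relation.Unary.All as All using (All; []; _∷_)
open import Data.List.Relation.Unary.All.Properties using (++⁻; map⁺)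
open import Data.List.Relation.Unary.Linked using (tail)
open import Data.List.Relation.Unary.Linked.Properties using (Linked⇒All)
open import Data.List.Relation.Unary.Sorted.TotalOrder ≤-totalOrder using (Sorted)
open import Data.List.Relation.Unary.Sorted.TotalOrder.Properties using (lookup-mono-≤)
open import Data.List.Relation.Binary.Permutation.Propositional using (_↭_)
open import Data.List.Relation.Binary.Permutation.Propositional.Properties using (↭-length; filter-↭; All-resp-↭)
open import Data.List.Relation.Ternary.Interleaving using ([])
open import Data.List.Relation.Ternary.Interleaving.Propositional using (Interleaving; consˡ; consʳ; toPermutation)
open import Data.List.Relation.Ternary.Interleaving.Properties using (interleave-length)
open import Data.List.Sort.InsertionSort.Base ≤-decTotalOrder using (sort)
open import Data.List.Sort.InsertionSort.Properties ≤-decTotalOrder using (sort-↭; sort-↗)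
open import Data.Product using (Σ; ∃₂; _×_; _,_; proj₁; proj₂)
open import Data.Sum using (inj₁; inj₂)
open import Function.Base using (_∘_)
open import Function.Bundles using (_⇔_; mk⇔; Equivalence)
open import Function.Properties.Equivalence using () renaming (refl to ⇔-refl; sym to ⇔-sym; trans to ⇔-trans)
open import Relation.Binary.PropositionalEquality
open import Relation.Nullary using (¬_; yes; no; contradiction)

open Equivalence using (to; from)

≤-cancel-offset : ∀ x {a b a′ b′ : ℕ} → a ≡ x + a′ → b ≡ x + b′ → a ≤ b ⇔ a′ ≤ b′
≤-cancel-offset x refl refl = mk⇔ (+-cancelˡ-≤ x _ _) (+-monoʳ-≤ x)

count≤ : ℕ → List ℕ → ℕ
count≤ u xs = length (filter (_≤? u) xs)

module _ {u : ℕ} where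

  count≤-accept : ∀ {x xs} → x ≤ u → count≤ u (x ∷ xs) ≡ suc (count≤ u xs)
  count≤-accept x≤u = cong length (filter-accept (_≤? u) x≤u)

  count≤-reject : ∀ {x xs} → ¬ x ≤ u → count≤ u (x ∷ xs) ≡ count≤ u xs
  count≤-reject x≰u = cong length (filter-reject (_≤? u) x≰u)

  count≤≤length : ∀ xs → count≤ u xs ≤ length xs
  count≤≤length = length-filter (_≤? u)

  count≤-all≤ : ∀ {xs} → All (_≤ u) xs → count≤ u xs ≡ length xs
  count≤-all≤ xs≤u = cong length (filter-all (_≤? u) xs≤u)

  count≤-all> : ∀ {xs} → All (u <_) xs → count≤ u xs ≡ 0
  count≤-all> xs>u = cong length (filter-none (_≤? u) (All.map <⇒≱ xs>u))

  count≤≡0⇒all> : ∀ xs → count≤ u xs ≡ 0 → All (u <_) xs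
  count≤≡0⇒all> [] _ = []
  count≤≡0⇒all> (x ∷ xs) c≡0 with x ≤? u
  ... | yes x≤u = contradiction (trans (sym (count≤-accept x≤u)) c≡0) λ ()
  ... | no x≰u = ≰⇒> x≰u ∷ count≤≡0⇒all> xs (trans (sym (count≤-reject x≰u)) c≡0)

  count≤-↭ : ∀ {xs ys} → xs ↭ ys → count≤ u xs ≡ count≤ u ys
  count≤-↭ xs↭ys = ↭-length (filter-↭ (_≤? u) xs↭ys)

  count≤-interleave : ∀ {γ δ π} → Interleaving γ δ π → count≤ u π ≡ count≤ u γ + count≤ u δ
  count≤-interleave {γ} {δ} {π} I = begin
    count≤ u π                                    ≡⟨ count≤-↭ (toPermutation I) ⟩
    length (filter (_≤? u) (γ ++ δ))              ≡⟨ cong length (filter-++ (_≤? u) γ δ) ⟩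
    length (filter (_≤? u) γ ++ filter (_≤? u) δ) ≡⟨ length-++ (filter (_≤? u) γ) ⟩
    count≤ u γ + count≤ u δ                       ∎
    where open ≡-Reasoning

count≤-map-+ : ∀ k w xs → count≤ (w + k) (map (_+ k) xs) ≡ count≤ w xs
count≤-map-+ k w [] = refl
count≤-map-+ k w (x ∷ xs) with x ≤? w
... | yes x≤w
  rewrite count≤-accept {w} {xs = xs} x≤w
        | count≤-accept {w + k} {xs = map (_+ k) xs} (+-monoˡ-≤ k x≤w) = cong suc (count≤-map-+ k w xs)
... | no x≰w
  rewrite count≤-reject {w} {xs = xs} x≰w
        | count≤-reject {w + k} {xs = map (_+ k) xs} (x≰w ∘ +-cancelʳ-≤ k x w) = count≤-map-+ k w xs

lookup≤⇔<count≤ : ∀ {v xs} → Sorted xs → (i : Fin (length xs)) → lookup xs i ≤ v ⇔ toℕ i < count≤ v xs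
lookup≤⇔<count≤ {v} {x ∷ xs} xs↗ i with x ≤? v
... | yes x≤v rewrite count≤-accept {v} {xs = xs} x≤v = atIndex i
  where
  atIndex : (i : Fin (length (x ∷ xs))) → lookup (x ∷ xs) i ≤ v ⇔ toℕ i < suc (count≤ v xs)
  atIndex fzero = mk⇔ (λ _ → s≤s z≤n) (λ _ → x≤v)
  atIndex (fsuc i) = mk⇔ (s≤s ∘ to ih) (from ih ∘ ≤-pred)
    where
    ih : lookup xs i ≤ v ⇔ toℕ i < count≤ v xs
    ih = lookup≤⇔<count≤ (tail xs↗) i
... | no x≰v = mk⇔
  (λ xᵢ≤v → contradiction (≤-trans (lookup-mono-≤ ≤-totalOrder xs↗ {fzero} {i} z≤n) xᵢ≤v) x≰v)
  (λ i<0 → contradiction (subst (toℕ i <_) none≤v i<0) λ ())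
  where
  none≤v : count≤ v (x ∷ xs) ≡ 0
  none≤v = count≤-all> (All.map (<-≤-trans (≰⇒> x≰v)) (Linked⇒All ≤-trans ≤-refl xs↗))

-- With r cars on s spots, the cars preferring a spot beyond u must fit into the s ∸ u spots beyond u.
FitsAbove : ℕ → ℕ → List ℕ → ℕ → Set
FitsAbove r s c u = u + r ≤ s + count≤ u c

FitsEverywhere : ℕ → ℕ → List ℕ → Set
FitsEverywhere r s c = ∀ u → u ≤ s → FitsAbove r s c u

FitsBefore : ℕ → ℕ → List ℕ → ℕ → Set
FitsBefore r s c j = ∀ u → u < j → FitsAbove r s c u

SortedBound : ℕ → ℕ → List ℕ → Set
SortedBound r s c = ∀ (i : Fin (length (sort c))) → lookup (sort c) i ≤ (s ∸ r) + suc (toℕ i)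

sortedBound⇔fitsEverywhere : ∀ {r s c} → r ≤ s → length c ≡ r → SortedBound r s c ⇔ FitsEverywhere r s c
sortedBound⇔fitsEverywhere {r} {s} {c} r≤s |c|≡r = mk⇔ sorted⇒fits fits⇒sorted
  where
  |sort|≡r : length (sort c) ≡ r
  |sort|≡r = trans (↭-length (sort-↭ c)) |c|≡r

  atIndex : ∀ i → lookup (sort c) i ≤ (s ∸ r) + suc (toℕ i) ⇔ FitsAbove r s c (s ∸ r + suc (toℕ i))
  atIndex i = ⇔-trans (lookup≤⇔<count≤ (sort-↗ c) i)
    (subst (λ t → suc (toℕ i) ≤ t ⇔ FitsAbove r s c u) (sym (count≤-↭ (sort-↭ c)))
      (⇔-sym (≤-cancel-offset s offset refl)))
    where
    u : ℕ
    u = s ∸ r + suc (toℕ i)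
    offset : u + r ≡ s + suc (toℕ i)
    offset = trans (+-comm u r) (trans (sym (+-assoc r (s ∸ r) _)) (cong (_+ suc (toℕ i)) (m+[n∸m]≡n r≤s)))

  sorted⇒fits : SortedBound r s c → FitsEverywhere r s c
  sorted⇒fits bound u u≤s with u ≤? s ∸ r
  ... | yes u≤s∸r = ≤-trans (≤-trans (+-monoˡ-≤ r u≤s∸r) (≤-reflexive (m∸n+n≡m r≤s))) (m≤m+n s _)
  ... | no u≰s∸r = subst (FitsAbove r s c) u≡
    (subst (λ t → FitsAbove r s c (s ∸ r + suc t)) (toℕ-fromℕ< w<|sort|) (to (atIndex i) (bound i)))
    where
    w : ℕ
    w = u ∸ suc (s ∸ r)
    u≡ : s ∸ r + suc w ≡ u
    u≡ = trans (+-suc (s ∸ r) w) (m+[n∸m]≡n (≰⇒> u≰s∸r))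
    w<|sort| : w < length (sort c)
    w<|sort| = subst (w <_) (sym |sort|≡r) (+-cancelˡ-≤ (s ∸ r) (suc w) r
      (≤-trans (≤-reflexive u≡) (≤-trans u≤s (≤-reflexive (sym (m∸n+n≡m r≤s))))))
    i : Fin (length (sort c))
    i = fromℕ< w<|sort|

  fits⇒sorted : FitsEverywhere r s c → SortedBound r s c
  fits⇒sorted fits i = from (atIndex i) (fits _ (≤-trans (+-monoʳ-≤ (s ∸ r) i<r) (≤-reflexive (m∸n+n≡m r≤s))))
    where
    i<r : suc (toℕ i) ≤ r
    i<r = subst (toℕ i <_) |sort|≡r (toℕ<n i)

IsCountPF : ℕ → ℕ → List ℕ → Set
IsCountPF r s c = r ≤ s × length c ≡ r × All (InRange s) c × FitsEverywhere r s c

isPF⇔isCountPF : ∀ {r s c} → IsPF r s c ⇔ IsCountPF r s c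
isPF⇔isCountPF {c = c} = mk⇔
  (λ (r≤s , |c| , c∈ , bound) → r≤s , |c| , c∈ , to (sortedBound⇔fitsEverywhere {c = c} r≤s |c|) bound)
  (λ (r≤s , |c| , c∈ , fits) → r≤s , |c| , c∈ , from (sortedBound⇔fitsEverywhere {c = c} r≤s |c|) fits)

fitsAbove-weaken : ∀ {r s c u} → FitsAbove (suc r) s c u → FitsAbove r s c u
fitsAbove-weaken {u = u} = ≤-trans (+-monoʳ-≤ u (n≤1+n _))

¬fitsAbove-length : ∀ {s c} → ¬ FitsAbove (suc (length c)) s c s
¬fitsAbove-length {s} {c} fits = n≮n (length c) (+-cancelˡ-≤ s _ _ (≤-trans fits (+-monoʳ-≤ s (count≤≤length c))))

fitsEverywhere-cons : ∀ {r s j c} → j ≤ s →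
  FitsEverywhere (suc r) s (j ∷ c) ⇔ (FitsEverywhere r s c × FitsBefore (suc r) s c j)
fitsEverywhere-cons {r} {s} {j} {c} j≤s = mk⇔ split join
  where
  aboveJ : ∀ {u} → j ≤ u → FitsAbove (suc r) s (j ∷ c) u ⇔ FitsAbove r s c u
  aboveJ {u} j≤u rewrite count≤-accept {u} {xs = c} j≤u = ≤-cancel-offset 1 (+-suc u r) (+-suc s _)

  belowJ : ∀ {u} → u < j → FitsAbove (suc r) s (j ∷ c) u ⇔ FitsAbove (suc r) s c u
  belowJ {u} u<j rewrite count≤-reject {u} {xs = c} (<⇒≱ u<j) = ⇔-refl

  split : FitsEverywhere (suc r) s (j ∷ c) → FitsEverywhere r s c × FitsBefore (suc r) s c j
  split fits = everywhere , below
    where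
    below : FitsBefore (suc r) s c j
    below u u<j = to (belowJ u<j) (fits u (≤-trans (<⇒≤ u<j) j≤s))
    everywhere : FitsEverywhere r s c
    everywhere u u≤s with j ≤? u
    ... | yes j≤u = to (aboveJ j≤u) (fits u u≤s)
    ... | no j≰u = fitsAbove-weaken {c = c} (below u (≰⇒> j≰u))

  join : FitsEverywhere r s c × FitsBefore (suc r) s c j → FitsEverywhere (suc r) s (j ∷ c)
  join (everywhere , below) u u≤s with j ≤? u
  ... | yes j≤u = from (aboveJ j≤u) (everywhere u u≤s)
  ... | no j≰u = from (belowJ (≰⇒> j≰u)) (below u (≰⇒> j≰u))

inA⇔ : ∀ {n π j} → suc (length π) ≤ n → All (InRange n) π → InRange n j →
  InA n π j ⇔ (FitsEverywhere (length π) n π × FitsBefore (suc (length π)) n π j)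
inA⇔ {π = π} m≤n π∈ j∈@(_ , j≤n) = mk⇔
  (λ (_ , pf) → to (fitsEverywhere-cons {c = π} j≤n) (proj₂ (proj₂ (proj₂ (to isPF⇔isCountPF pf)))))
  (λ fits → j∈ , from isPF⇔isCountPF (m≤n , refl , j∈ ∷ π∈ , from (fitsEverywhere-cons j≤n) fits))

Threshold : ℕ → List ℕ → ℕ → Set
Threshold n π k =
  FitsEverywhere (length π) n π ×
  FitsBefore (suc (length π)) n π k ×
  ¬ FitsAbove (suc (length π)) n π k

A≡[k]⇔threshold : ∀ {n π k} → suc (length π) ≤ n → All (InRange n) π → InRange n k →
  A≡[k] n π k ⇔ Threshold n π k
A≡[k]⇔threshold {n} {π} {k} m≤n π∈ (1≤k , k≤n) = mk⇔ threshold interval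
  where
  inA : ∀ {j} → InRange n j →
    InA n π j ⇔ (FitsEverywhere (length π) n π × FitsBefore (suc (length π)) n π j)
  inA = inA⇔ m≤n π∈

  threshold : A≡[k] n π k → Threshold n π k
  threshold A≡[k] with to (inA (1≤k , k≤n)) (from (A≡[k] k) (1≤k , ≤-refl))
  ... | fits , below = fits , below , ¬fitsAtK
    where
    ¬fitsAtK : ¬ FitsAbove (suc (length π)) n π k
    ¬fitsAtK fitsAtK with m≤n⇒m<n∨m≡n k≤n
    ... | inj₂ refl = ¬fitsAbove-length {c = π} fitsAtK
    ... | inj₁ k<n = 1+n≰n (proj₂ (to (A≡[k] (suc k)) (from (inA (s≤s z≤n , k<n)) (fits , belowSuc))))
      where
      belowSuc : FitsBefore (suc (length π)) n π (suc k)
      belowSuc u u<1+k with m≤n⇒m<n∨m≡n (≤-pred u<1+k)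
      ... | inj₁ u<k = below u u<k
      ... | inj₂ refl = fitsAtK

  interval : Threshold n π k → A≡[k] n π k
  interval (fits , below , ¬fitsAtK) j = mk⇔
    (λ j∈A → proj₁ (proj₁ j∈A) , ≮⇒≥ λ k<j → ¬fitsAtK (proj₂ (to (inA (proj₁ j∈A)) j∈A) k k<j))
    (λ (1≤j , j≤k) → from (inA (1≤j , ≤-trans j≤k k≤n)) (fits , λ u u<j → below u (<-≤-trans u<j j≤k)))

-- Linear arithmetic behind the shuffle decomposition: p = |π|, r = |γ|, d = |b|, and C is a
-- count on π split along the shuffle.
module _ {r d p : ℕ} (p≡r+d : p ≡ r + d) where

  ≤-cancel-below : ∀ {k′ u c C} → C ≡ c + 0 → u + suc p ≤ suc k′ + d + C ⇔ u + r ≤ k′ + c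
  ≤-cancel-below {k′} {u} {c} refl rewrite p≡r+d = ≤-cancel-offset (suc d) (eq₁ u r d) (eq₂ k′ d c)
    where
    eq₁ : ∀ u r d → u + suc (r + d) ≡ suc d + (u + r)
    eq₁ = solve-∀
    eq₂ : ∀ k′ d c → suc k′ + d + (c + 0) ≡ suc d + (k′ + c)
    eq₂ = solve-∀

  ≤-cancel-above : ∀ {k w c C} → C ≡ r + c → w + k + p ≤ k + d + C ⇔ w + d ≤ d + c
  ≤-cancel-above {k} {w} {c} refl rewrite p≡r+d = ≤-cancel-offset (k + r) (eq₁ w k r d) (eq₂ k d r c)
    where
    eq₁ : ∀ w k r d → w + k + (r + d) ≡ k + r + (w + d)
    eq₁ = solve-∀
    eq₂ : ∀ k d r c → k + d + (r + c) ≡ k + r + (d + c)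
    eq₂ = solve-∀

  ≰-at-threshold : ∀ {k C} → C ≡ r + 0 → ¬ (k + suc p ≤ k + d + C)
  ≰-at-threshold {k} refl rewrite p≡r+d = 1+n≰n ∘ ≤-trans (≤-reflexive (eq k r d))
    where
    eq : ∀ k r d → suc (k + d + (r + 0)) ≡ k + suc (r + d)
    eq = solve-∀

  threshold-forces : ∀ {n k′ c C₁ C₂} → C₁ ≡ r + 0 → C₂ ≡ r + c →
    k′ + suc p ≤ n + C₁ → ¬ (suc k′ + suc p ≤ n + C₂) → c ≡ 0 × n ≡ suc k′ + d
  threshold-forces {n} {k′} {c} refl refl fits ¬fits = n≤0⇒n≡0 c≤0 , +-cancelʳ-≡ r n (suc k′ + d) n+r≡
    where
    over : n + (r + c) ≤ k′ + suc p
    over = ≤-pred (≰⇒> ¬fits)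
    c≤0 : c ≤ 0
    c≤0 = +-cancelˡ-≤ r c 0 (+-cancelˡ-≤ n _ _ (≤-trans over fits))
    tight : k′ + suc p ≡ n + (r + 0)
    tight = ≤-antisym fits (≤-trans (+-monoʳ-≤ n (+-monoʳ-≤ r z≤n)) over)
    eq : ∀ k′ r d → k′ + suc (r + d) ≡ suc k′ + d + r
    eq = solve-∀
    n+r≡ : n + r ≡ suc k′ + d + r
    n+r≡ = begin
      n + r            ≡⟨ cong (n +_) (+-identityʳ r) ⟨
      n + (r + 0)      ≡⟨ tight ⟨
      k′ + suc p       ≡⟨ cong (λ t → k′ + suc t) p≡r+d ⟩
      k′ + suc (r + d) ≡⟨ eq k′ r d ⟩
      suc k′ + d + r   ∎
      where open ≡-Reasoning

shuffle-length : ∀ {γ b π} (f : ℕ → ℕ) → Interleaving γ (map f b) π → length π ≡ length γ + length b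
shuffle-length {γ} {b} f I = trans (interleave-length I) (cong (length γ +_) (length-map f b))

module _ {k′ : ℕ} {γ b π : List ℕ} (I : Interleaving γ (map (_+ suc k′) b) π)
         (γ≤k′ : All (_≤ k′) γ) (b≥1 : All (1 ≤_) b) where

  private
    |π|≡ : length π ≡ length γ + length b
    |π|≡ = shuffle-length (_+ suc k′) I

    count≤-below : ∀ {u} → u ≤ k′ → count≤ u π ≡ count≤ u γ + 0
    count≤-below {u} u≤k′ =
      trans (count≤-interleave I) (cong (count≤ u γ +_) (count≤-all> (map⁺ (All.map above b≥1))))
      where
      above : ∀ {x} → 1 ≤ x → u < x + suc k′
      above {x} _ = ≤-trans (s≤s u≤k′) (m≤n+m (suc k′) x)

    count≤-above : ∀ w → count≤ (w + suc k′) π ≡ length γ + count≤ w b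
    count≤-above w =
      trans (count≤-interleave I) (cong₂ _+_ (count≤-all≤ (All.map below γ≤k′)) (count≤-map-+ (suc k′) w b))
      where
      below : ∀ {x} → x ≤ k′ → x ≤ w + suc k′
      below x≤k′ = ≤-trans x≤k′ (≤-trans (n≤1+n k′) (m≤n+m (suc k′) w))

  threshold⇔fitsEverywhere : Threshold (suc k′ + length b) π (suc k′) ⇔
    (FitsEverywhere (length γ) k′ γ × FitsEverywhere (length b) (length b) b)
  threshold⇔fitsEverywhere = mk⇔ split join
    where
    n : ℕ
    n = suc k′ + length b

    fitsLow : ∀ {u} → u ≤ k′ → FitsAbove (suc (length π)) n π u ⇔ FitsAbove (length γ) k′ γ u
    fitsLow u≤k′ = ≤-cancel-below {length γ} {length b} |π|≡ (count≤-below u≤k′)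

    fitsHigh : ∀ w → FitsAbove (length π) n π (w + suc k′) ⇔ FitsAbove (length b) (length b) b w
    fitsHigh w = ≤-cancel-above {length γ} {length b} |π|≡ {k = suc k′} (count≤-above w)

    split : Threshold n π (suc k′) → FitsEverywhere (length γ) k′ γ × FitsEverywhere (length b) (length b) b
    split (fits , below , _) =
      (λ u u≤k′ → to (fitsLow u≤k′) (below u (s≤s u≤k′))) ,
      (λ w w≤d → to (fitsHigh w)
        (fits (w + suc k′) (≤-trans (+-monoˡ-≤ (suc k′) w≤d) (≤-reflexive (+-comm _ (suc k′))))))

    join : FitsEverywhere (length γ) k′ γ × FitsEverywhere (length b) (length b) b → Threshold n π (suc k′)
    join (fitsγ , fitsb) = fits , below , ≰-at-threshold {length γ} {length b} |π|≡ count≤-at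
      where
      count≤-at : count≤ (suc k′) π ≡ length γ + 0
      count≤-at = trans (count≤-above 0) (cong (length γ +_) (count≤-all> b≥1))
      below : FitsBefore (suc (length π)) n π (suc k′)
      below u u<k = from (fitsLow (≤-pred u<k)) (fitsγ u (≤-pred u<k))
      fits : FitsEverywhere (length π) n π
      fits u u≤n with u ≤? k′
      ... | yes u≤k′ = fitsAbove-weaken {c = π} (below u (s≤s u≤k′))
      ... | no u≰k′ = subst (FitsAbove (length π) n π) (m∸n+n≡m (≰⇒> u≰k′))
        (from (fitsHigh w) (fitsb w (≤-trans (∸-monoˡ-≤ (suc k′) u≤n) (≤-reflexive (m+n∸m≡n (suc k′) _)))))
        where
        w : ℕ
        w = u ∸ suc k′

record ShuffleDecomposition (k′ : ℕ) (π : List ℕ) : Set where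
  field
    γ b : List ℕ
    interleaving : Interleaving γ (map (_+ suc k′) b) π
    γ-isPF : IsPF (length γ) k′ γ
    b-isPF : IsPF (length b) (length b) b

Decomposes : ℕ → ℕ → List ℕ → Set
Decomposes n k′ π = Σ (ShuffleDecomposition k′ π) λ D → n ≡ suc k′ + length (ShuffleDecomposition.b D)

inSh⇔decomposes : ∀ {n k′ π} → suc k′ ≤ n → InSh (suc (length π)) n (suc k′) π ⇔ Decomposes n k′ π
inSh⇔decomposes {n} {k′} {π} k≤n = mk⇔ decompose compose
  where
  decompose : InSh (suc (length π)) n (suc k′) π → Decomposes n k′ π
  decompose (_ , r , _ , γ , b , γ-isPF , b-isPF , I) =
    record { γ = γ ; b = b ; interleaving = I
           ; γ-isPF = subst (λ t → IsPF t k′ γ) (sym |γ|≡r) γ-isPF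
           ; b-isPF = subst (λ t → IsPF t t b) (sym |b|≡n∸k) b-isPF } ,
    trans (sym (m+[n∸m]≡n k≤n)) (cong (suc k′ +_) (sym |b|≡n∸k))
    where
    |γ|≡r : length γ ≡ r
    |γ|≡r = proj₁ (proj₂ γ-isPF)
    |b|≡n∸k : length b ≡ n ∸ suc k′
    |b|≡n∸k = proj₁ (proj₂ b-isPF)

  compose : Decomposes n k′ π → InSh (suc (length π)) n (suc k′) π
  compose (record { γ = γ ; b = b ; interleaving = I ; γ-isPF = γ-isPF ; b-isPF = b-isPF } , refl) =
    refl , length γ , sizes , γ , b , γ-isPF , subst (λ t → IsPF t t b) (sym n∸k≡|b|) b-isPF , I
    where
    n∸k≡|b| : suc k′ + length b ∸ suc k′ ≡ length b
    n∸k≡|b| = m+n∸m≡n (suc k′) (length b)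
    sizes : length γ + (suc k′ + length b ∸ suc k′) + 1 ≡ suc (length π)
    sizes = begin
      length γ + (suc k′ + length b ∸ suc k′) + 1 ≡⟨ cong (λ t → length γ + t + 1) n∸k≡|b| ⟩
      length γ + length b + 1                     ≡⟨ +-comm _ 1 ⟩
      suc (length γ + length b)                   ≡⟨ cong suc (shuffle-length (_+ suc k′) I) ⟨
      suc (length π)                              ∎
      where open ≡-Reasoning

partition-≤ : ∀ t π → ∃₂ λ γ δ → Interleaving γ δ π × All (_≤ t) γ × All (t <_) δ
partition-≤ t [] = [] , [] , [] , [] , []
partition-≤ t (x ∷ π) with partition-≤ t π | x ≤? t
... | γ , δ , I , γ≤t , δ>t | yes x≤t = x ∷ γ , δ , consˡ I , x≤t ∷ γ≤t , δ>t
... | γ , δ , I , γ≤t , δ>t | no x≰t = γ , x ∷ δ , consʳ I , γ≤t , ≰⇒> x≰t ∷ δ>t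

all-interleave : ∀ {P : ℕ → Set} {γ δ π} → Interleaving γ δ π → All P π → All P γ × All P δ
all-interleave {γ = γ} I π∈ = ++⁻ γ (All-resp-↭ (toPermutation I) π∈)

map-+-∸ : ∀ k {xs} → All (k ≤_) xs → map (_+ k) (map (_∸ k) xs) ≡ xs
map-+-∸ k [] = refl
map-+-∸ k (k≤x ∷ k≤xs) = cong₂ _∷_ (m∸n+n≡m k≤x) (map-+-∸ k k≤xs)

threshold⇒partition : ∀ {n k′ π} → Threshold n π (suc k′) →
  ∃₂ λ γ δ → Interleaving γ δ π × All (_≤ k′) γ × All (suc k′ <_) δ × n ≡ suc k′ + length δ
threshold⇒partition {n} {k′} {π} (_ , below , ¬fitsAtK) with partition-≤ k′ π
... | γ , δ , I , γ≤k′ , δ>k′ = γ , δ , I , γ≤k′ , count≤≡0⇒all> δ (proj₁ forced) , proj₂ forced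
  where
  count≤-k′ : count≤ k′ π ≡ length γ + 0
  count≤-k′ = trans (count≤-interleave I) (cong₂ _+_ (count≤-all≤ γ≤k′) (count≤-all> δ>k′))
  count≤-k : count≤ (suc k′) π ≡ length γ + count≤ (suc k′) δ
  count≤-k = trans (count≤-interleave I) (cong (_+ _) (count≤-all≤ (All.map m≤n⇒m≤1+n γ≤k′)))
  forced : count≤ (suc k′) δ ≡ 0 × n ≡ suc k′ + length δ
  forced = threshold-forces {length γ} {length δ} (interleave-length I) count≤-k′ count≤-k
             (below k′ ≤-refl) ¬fitsAtK

threshold⇒decomposes : ∀ {n k′ π} → suc (length π) ≤ n → All (InRange n) π →
  Threshold n π (suc k′) → Decomposes n k′ π
threshold⇒decomposes {n} {k′} {π} m≤n π∈ T with threshold⇒partition T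
... | γ , δ , I , γ≤k′ , δ>k , n≡k+|δ| = D , n≡k+|b|
  where
  b : List ℕ
  b = map (_∸ suc k′) δ
  I′ : Interleaving γ (map (_+ suc k′) b) π
  I′ = subst (λ t → Interleaving γ t π) (sym (map-+-∸ (suc k′) (All.map <⇒≤ δ>k))) I
  n≡k+|b| : n ≡ suc k′ + length b
  n≡k+|b| = trans n≡k+|δ| (cong (suc k′ +_) (sym (length-map _ δ)))
  fits : FitsEverywhere (length γ) k′ γ × FitsEverywhere (length b) (length b) b
  fits = to (threshold⇔fitsEverywhere I′ γ≤k′ (map⁺ (All.map m<n⇒0<n∸m δ>k)))
            (subst (λ t → Threshold t π (suc k′)) n≡k+|b| T)
  |γ|≤k′ : length γ ≤ k′
  |γ|≤k′ = +-cancelʳ-≤ (length δ) _ _ (≤-pred (begin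
    suc (length γ + length δ) ≡⟨ cong suc (interleave-length I) ⟨
    suc (length π)            ≤⟨ m≤n ⟩
    n                         ≡⟨ n≡k+|δ| ⟩
    suc k′ + length δ         ∎))
    where open ≤-Reasoning
  γ∈ : All (InRange k′) γ
  γ∈ = All.zipWith (λ ((1≤x , _) , x≤k′) → 1≤x , x≤k′) (proj₁ (all-interleave I π∈) , γ≤k′)
  b∈ : All (InRange (length b)) b
  b∈ = map⁺ (All.zipWith shift (δ>k , proj₂ (all-interleave I π∈)))
    where
    shift : ∀ {x} → suc k′ < x × InRange n x → InRange (length b) (x ∸ suc k′)
    shift (k<x , _ , x≤n) = m<n⇒0<n∸m k<x ,
      ≤-trans (∸-monoˡ-≤ (suc k′) (≤-trans x≤n (≤-reflexive n≡k+|b|))) (≤-reflexive (m+n∸m≡n (suc k′) _))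
  D : ShuffleDecomposition k′ π
  D = record { γ = γ ; b = b ; interleaving = I′
             ; γ-isPF = from isPF⇔isCountPF (|γ|≤k′ , refl , γ∈ , proj₁ fits)
             ; b-isPF = from isPF⇔isCountPF (≤-refl , refl , b∈ , proj₂ fits) }

decomposes⇒threshold : ∀ {n k′ π} → Decomposes n k′ π → Threshold n π (suc k′)
decomposes⇒threshold (record { interleaving = I ; γ-isPF = γ-isPF ; b-isPF = b-isPF } , refl)
  with to isPF⇔isCountPF γ-isPF | to isPF⇔isCountPF b-isPF
... | _ , _ , γ∈ , fitsγ | _ , _ , b∈ , fitsb =
  from (threshold⇔fitsEverywhere I (All.map proj₂ γ∈) (All.map proj₁ b∈)) (fitsγ , fitsb)

threshold⇔decomposes : ∀ {n k′ π} → suc (length π) ≤ n → All (InRange n) π →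
  Threshold n π (suc k′) ⇔ Decomposes n k′ π
threshold⇔decomposes m≤n π∈ = mk⇔ (threshold⇒decomposes m≤n π∈) decomposes⇒threshold

theorem4p6 : (m n : ℕ) → 1 ≤ m → m ≤ n →
    (π : List ℕ) → length π ≡ m ∸ 1 → All (InRange n) π →
    (k : ℕ) → InRange n k →
    A≡[k] n π k ⇔ InSh m n k π
theorem4p6 (suc _) n _ m≤n π refl π∈ (suc k′) k∈@(_ , k≤n) =
  ⇔-trans (A≡[k]⇔threshold m≤n π∈ k∈)
  (⇔-trans (threshold⇔decomposes m≤n π∈) (⇔-sym (inSh⇔decomposes k≤n)))
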